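{- Let $(C_0, I, O)$ be an ILP Modulo $T$ instance and consider the $\mathrm{BC}(T)$ transition system for it. For any states $\langle P, A\rangle$ and $\langle P', A'\rangle$ with $\langle P, A\rangle \longrightarrow^* \langle P', A'\rangle$: if there is an integer assignment $B$ that is a $T$-model of $C \wedge D \wedge I$ for some subproblem $\langle C, D\rangle \in P$, then either $obj(A') \le obj(B)$, or $B$ is a $T$-model of $C' \wedge D' \wedge I$ for some subproblem $\langle C', D'\rangle \in P'$.
   Context: Fix a set $\mathcal V$ of integer variables. An integer linear constraint has the form $c_1v_1+\dots+c_nv_n \bowtie r$ with integers $c_i, r$, $v_i \in \mathcal V$, $\bowtie \in \{<,\le,=,>,\ge\}$; an integer linear formula is a finite set (conjunction) of such constraints. An integer assignment is a function $A:\mathcal V\to\mathbb Z$, identified with the set of formulas $\{v = A(v) : v\in\mathcal V\}$. $\mathcal Z$ denotes the theory of linear integer arithmetic (all first-order sentences over the signature $0,\pm1,\pm2,\dots,+,-,\le$ true in the standard model $\mathbb Z$). For a theory $T'$, a formula $F$ is $T'$-consistent if $F\wedge T'$ has a model, and $F\models_{T'} G$ means $F\wedge\neg G$ is $T'$-inconsistent. Let $T$ be a $\Sigma$-theory with $\Sigma$ disjoint from the signature of $\mathcal Z$. A $\Sigma$-interface atom is a $\Sigma$-atomic formula $t$, possibly annotated with a variable $v$ (written $t^v$), the annotation meaning $t \Leftrightarrow v>0$. An ILP Modulo $T$ instance is a triple $(C_0, I, O)$ with $C_0$ an integer linear formula, $I$ a set of $\Sigma$-interface atoms, and $O=\sum_i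 c_i v_i$ an integer linear expression to be minimized. For an assignment $A$, $obj(A)=\sum_i c_iA(v_i)$; also $obj(\mathrm{none})=+\infty$ and $obj(A^{ -\infty})=-\infty$. An assignment $A$ is a $T$-model of a formula $F$ if $A$ is $T$-consistent and $A\models_{\mathcal Z\cup T} F$. A simple equality is a constraint $v_i=c$ or $v_i-v_j=c$ ($c$ an integer constant). A subproblem is a pair $\langle C, D\rangle$ with $C$ a set of integer linear constraints and $D$ a set of simple equalities. A state is a pair $\langle P, A\rangle$ where $P$ is a set of subproblems and $A$ is either the constant $\mathrm{none}$, an assignment, or an assignment annotated with superscript $-\infty$. A fixed function $lb$ on subproblems satisfies: no assignment $A$ satisfying $C\wedge D$ has $obj(A) < lb(\langle C,D\rangle)$. Notation: $P\uplus Q$ is union of disjoint sets; $C\,c$ is $C\cup\{c\}$ with $c\notin C$ (likewise $D\,d$). The transition relation $\longrightarrow$ of $\mathrm{BC}(T)$ is given by the rules: Branch: $\langle P\uplus\{\langle C,D\rangle\}, A\rangle \longrightarrow \langle P\cup\{\langle C_i,D\rangle : 1\le i\le n\}, A\rangle$ if $n>1$, $D\models_{\mathcal Z}(C\Leftrightarrow\bigvee_{i} C_i)$, and the $C_i$ are syntactically distinct. Learn: $\langle P\uplus\{\langle C,D\rangle\},A\rangle\longrightarrow\langle P\cup\{\langle C\,c,D\rangle\},A\rangle$ if $C\wedge D\models_{\mathcal Z} c$. Forget: $\langle P\uplus\{\langle C\,c,D\rangle\},A\rangle\longrightarrow\langle P\cup\{\langle C,D\rangle\},A\rangle$ if $C\wedge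 D\models_{\mathcal Z} c$. Propagate: $\langle P\uplus\{\langle C,D\rangle\},A\rangle\longrightarrow\langle P\cup\{\langle C,D\,d\rangle\},A\rangle$ if $d$ is a simple equality and $C\wedge D\models_{\mathcal Z} d$. Drop: $\langle P\uplus\{\langle C,D\rangle\},A\rangle\longrightarrow\langle P,A\rangle$ if $C\wedge D$ has no integer solution. Prune: $\langle P\uplus\{\langle C,D\rangle\},A\rangle\longrightarrow\langle P,A\rangle$ if $A\neq\mathrm{none}$ and $lb(\langle C,D\rangle)\ge obj(A)$. Retire: $\langle P\uplus\{\langle C,D\rangle\},A\rangle\longrightarrow\langle P,A'\rangle$ if $A'$ is a $T$-model of $C\wedge D\wedge I$, $obj(A')<obj(A)$, and $obj(A')\le obj(B)$ for every $T$-model $B$ of $C\wedge D\wedge I$. Unbounded: $\langle P\uplus\{\langle C,D\rangle\},A\rangle\longrightarrow\langle \emptyset,A'^{ -\infty}\rangle$ if $A'$ is a $T$-model of $C\wedge D\wedge I$, $obj(A')\le obj(A)$, and for every $k$ there is a $T$-model $B$ of $C\wedge D\wedge I$ with $obj(B)<k$. T-Learn: $\langle P\uplus\{\langle C,D\rangle\},A\rangle\longrightarrow\langle P\cup\{\langle C\,c,D\rangle\},A\rangle$ if there is a formula $F$ with $C\wedge D\models_{\mathcal Z} F$ and $F\wedge I\models_T c$. $S\longrightarrow^* S'$ means $S=S'$ or there is a finite nonempty chain of $\longrightarrow$ transitions from $S$ to $S'$. -}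

module Defs where

open import Level using (0ℓ)
open import Data.Integer using (ℤ; _+_; _-_; _*_; _<_; _≤_; 0ℤ)
open import Data.List using (List; []; _∷_; map; length; _++_)
open import Data.List.Membership.Propositional using (_∈_; _∉_)
open import Data.List.Relation.Unary.All using (All)
open import Data.List.Relation.Unary.Any using (Any)
open import Data.List.Relation.Unary.AllPairs using (AllPairs)
open import Data.Nat using (ℕ)
import Data.Nat as ℕ
open import Data.Maybe using (Maybe; just; nothing)
open import Data.Product using (Σ; ∃; _×_; _,_; proj₁; proj₂)
open import Data.Sum using (_⊎_)
open import Relation.Nullary using (¬_)
open import Relation.Binary.PropositionalEquality using (_≡_; _≢_)
open import Relation.Binary.Construct.Closure.ReflexiveTransitive using (Star)
open import Function.Bundles using (_⇔_)

data RelOp : Set where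
  `< `≤ `= `> `≥ : RelOp

record LinCon (V : Set) : Set where
  constructor lincon
  field
    terms : List (ℤ × V)
    op    : RelOp
    rhs   : ℤ

Assignment : Set → Set
Assignment V = V → ℤ

evalLin : {V : Set} → Assignment V → List (ℤ × V) → ℤ
evalLin α []             = 0ℤ
evalLin α ((c , v) ∷ ts) = c * α v + evalLin α ts

holdsOp : RelOp → ℤ → ℤ → Set
holdsOp `< l r = l < r
holdsOp `≤ l r = l ≤ r
holdsOp `= l r = l ≡ r
holdsOp `> l r = r < l
holdsOp `≥ l r = r ≤ l

satCon : {V : Set} → Assignment V → LinCon V → Set
satCon α (lincon ts o r) = holdsOp o (evalLin α ts) r

satCons : {V : Set} → Assignment V → List (LinCon V) → Set
satCons α C = All (satCon α) C

data SimpleEq (V : Set) : Set where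
  var≐  : V → ℤ → SimpleEq V
  diff≐ : V → V → ℤ → SimpleEq V

satEq : {V : Set} → Assignment V → SimpleEq V → Set
satEq α (var≐ v c)    = α v ≡ c
satEq α (diff≐ v w c) = α v - α w ≡ c

satEqs : {V : Set} → Assignment V → List (SimpleEq V) → Set
satEqs α D = All (satEq α) D

-- finite sets are represented by lists; two lists denote the same set
-- when they have the same members
SameSet : {A : Set} → List A → List A → Set
SameSet xs ys = ∀ a → (a ∈ xs) ⇔ (a ∈ ys)

record Subproblem (V : Set) : Set where
  constructor ⟨_,_⟩
  field
    cons : List (LinCon V)
    eqs  : List (SimpleEq V)
open Subproblem public

_≈S_ : {V : Set} → Subproblem V → Subproblem V → Set
x ≈S y = SameSet (cons x) (cons y) × SameSet (eqs x) (eqs y)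

_∈S_ : {V : Set} → Subproblem V → List (Subproblem V) → Set
x ∈S P = Any (x ≈S_) P

satSub : {V : Set} → Assignment V → Subproblem V → Set
satSub α x = satCons α (cons x) × satEqs α (eqs x)

_⊨Z_ : {V : Set} → Subproblem V → (Assignment V → Set) → Set
x ⊨Z G = ∀ α → satSub α x → G α

-- Abstract semantics of the combined theory Z ∪ T:
--   Str   : the models of Z ∪ T together with an interpretation of the
--           free variables (integer sort interpreted as ℤ),
--   val   : the integer value each variable receives,
--   holds : whether a Σ-atomic formula is true in the structure.
record Semantics (V Atom : Set) : Set₁ where
  field
    Str   : Set
    val   : Str → Assignment V
    holds : Str → Atom → Set

-- Σ-interface atom  t  or  tᵛ  (annotation: t ⇔ v > 0)
record IAtom (V Atom : Set) : Set where
  constructor iatom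
  field
    atom : Atom
    ann  : Maybe V

record Instance (V Atom : Set) : Set where
  field
    C₀ : List (LinCon V)
    I  : List (IAtom V Atom)
    O  : List (ℤ × V)       -- objective Σ cᵢ vᵢ to be minimised

module _ {V Atom : Set} (Sm : Semantics V Atom) where
  open Semantics Sm

  satIAtom : Str → IAtom V Atom → Set
  satIAtom M (iatom t nothing)  = holds M t
  satIAtom M (iatom t (just v)) = holds M t ⇔ (0ℤ < val M v)

  satI : Str → List (IAtom V Atom) → Set
  satI M I = All (satIAtom M) I

  satSubI : List (IAtom V Atom) → Subproblem V → Str → Set
  satSubI I x M = satSub (val M) x × satI M I

  -- the assignment B (as the set {v = B v}) is T-consistent
  TConsistent : Assignment V → Set
  TConsistent B = Σ Str λ M → ∀ v → val M v ≡ B v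

  _⊨ZT_ : Assignment V → (Str → Set) → Set
  B ⊨ZT F = ∀ M → (∀ v → val M v ≡ B v) → F M

  TModel : Assignment V → (Str → Set) → Set
  TModel B F = TConsistent B × (B ⊨ZT F)

data Ext : Set where
  -∞  : Ext
  fin : ℤ → Ext
  +∞  : Ext

data _≤ᴱ_ : Ext → Ext → Set where
  -∞≤  : ∀ {e} → -∞ ≤ᴱ e
  fin≤ : ∀ {a b} → a ≤ b → fin a ≤ᴱ fin b
  ≤+∞  : ∀ {e} → e ≤ᴱ +∞

data _<ᴱ_ : Ext → Ext → Set where
  -∞<fin : ∀ {a} → -∞ <ᴱ fin a
  -∞<+∞  : -∞ <ᴱ +∞
  fin<   : ∀ {a b} → a < b → fin a <ᴱ fin b
  fin<+∞ : ∀ {a} → fin a <ᴱ +∞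

data AState (V : Set) : Set where
  none : AState V
  asg  : Assignment V → AState V
  unb  : Assignment V → AState V

obj : {V : Set} → List (ℤ × V) → Assignment V → ℤ
obj O A = evalLin A O

objS : {V : Set} → List (ℤ × V) → AState V → Ext
objS O none    = +∞
objS O (asg A) = fin (obj O A)
objS O (unb A) = -∞

record State (V : Set) : Set where
  constructor ⟪_,_⟫
  field
    P : List (Subproblem V)
    A : AState V
open State public

LBSound : {V : Set} → List (ℤ × V) → (Subproblem V → Ext) → Set
LBSound O lb = ∀ x α → satSub α x → ¬ (fin (obj O α) <ᴱ lb x)

-- P' = (P ⊎ {x}) with x replaced by the set Q, i.e.  P' = P ∪ Q
Replace : {V : Set} → List (Subproblem V) → Subproblem V →
          List (Subproblem V) → List (Subproblem V) → Set
Replace P x Q P' =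
  x ∈S P × (∀ y → (y ∈S P') ⇔ ((y ∈S P × ¬ (y ≈S x)) ⊎ y ∈S Q))

module BC {V Atom : Set} (Sm : Semantics V Atom) (inst : Instance V Atom)
          (lb : Subproblem V → Ext) where
  open Semantics Sm
  open Instance inst

  CDI : Subproblem V → Str → Set
  CDI x = satSubI Sm I x

  data _⟶_ : State V → State V → Set₁ where
    branch : ∀ {P P' A C D} (Cs : List (List (LinCon V))) →
      2 ℕ.≤ length Cs →
      (∀ α → satEqs α D →
         (satCons α C ⇔ Any (satCons α) Cs)) →
      AllPairs (λ C₁ C₂ → ¬ SameSet C₁ C₂) Cs →
      Replace P ⟨ C , D ⟩ (map (λ Cᵢ → ⟨ Cᵢ , D ⟩) Cs) P' →
      ⟪ P , A ⟫ ⟶ ⟪ P' , A ⟫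
    learn : ∀ {P P' A C D} (c : LinCon V) → c ∉ C →
      ⟨ C , D ⟩ ⊨Z (λ α → satCon α c) →
      Replace P ⟨ C , D ⟩ (⟨ c ∷ C , D ⟩ ∷ []) P' →
      ⟪ P , A ⟫ ⟶ ⟪ P' , A ⟫
    forget : ∀ {P P' A C D} (c : LinCon V) → c ∉ C →
      ⟨ C , D ⟩ ⊨Z (λ α → satCon α c) →
      Replace P ⟨ c ∷ C , D ⟩ (⟨ C , D ⟩ ∷ []) P' →
      ⟪ P , A ⟫ ⟶ ⟪ P' , A ⟫
    propagate : ∀ {P P' A C D} (d : SimpleEq V) → d ∉ D →
      ⟨ C , D ⟩ ⊨Z (λ α → satEq α d) →
      Replace P ⟨ C , D ⟩ (⟨ C , d ∷ D ⟩ ∷ []) P' →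
      ⟪ P , A ⟫ ⟶ ⟪ P' , A ⟫
    drop : ∀ {P P' A} (x : Subproblem V) →
      ¬ (Σ (Assignment V) λ α → satSub α x) →
      Replace P x [] P' →
      ⟪ P , A ⟫ ⟶ ⟪ P' , A ⟫
    prune : ∀ {P P' A} (x : Subproblem V) →
      A ≢ none →
      objS O A ≤ᴱ lb x →
      Replace P x [] P' →
      ⟪ P , A ⟫ ⟶ ⟪ P' , A ⟫
    retire : ∀ {P P' A} (x : Subproblem V) (A' : Assignment V) →
      TModel Sm A' (CDI x) →
      fin (obj O A') <ᴱ objS O A →
      (∀ B → TModel Sm B (CDI x) → obj O A' ≤ obj O B) →
      Replace P x [] P' →
      ⟪ P , A ⟫ ⟶ ⟪ P' , asg A' ⟫
    unbounded : ∀ {P A} (x : Subproblem V) (A' : Assignment V) →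
      x ∈S P →
      TModel Sm A' (CDI x) →
      fin (obj O A') ≤ᴱ objS O A →
      (∀ (k : ℤ) → Σ (Assignment V) λ B → TModel Sm B (CDI x) × obj O B < k) →
      ⟪ P , A ⟫ ⟶ ⟪ [] , unb A' ⟫
    t-learn : ∀ {P P' A C D} (c : LinCon V) → c ∉ C →
      (Σ (Assignment V → Set) λ F →
         (⟨ C , D ⟩ ⊨Z F) ×
         (∀ M → F (val M) → satI Sm M I → satCon (val M) c)) →
      Replace P ⟨ C , D ⟩ (⟨ c ∷ C , D ⟩ ∷ []) P' →
      ⟪ P , A ⟫ ⟶ ⟪ P' , A ⟫

  _⟶*_ : State V → State V → Set₁
  _⟶*_ = Star _⟶_

-- Fix B and call it "alive" in a state when it satisfies C ∧ D for some
-- subproblem ⟨C, D⟩ of the state. Every rule either keeps B alive (Branch, Learn,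
-- Forget, Propagate and T-Learn only replace a subproblem by equisatisfiable or
-- entailed ones; Drop removes only unsatisfiable ones) or, when it discards the
-- subproblem satisfied by B, yields an incumbent with objective at most obj(B)
-- (Prune by soundness of lb, Retire by optimality, Unbounded trivially). Since the
-- incumbent objective never increases, the conclusion persists along ⟶*.
module Submission where

open import Defs
open import Data.Integer using (ℤ)
open import Data.Product using (Σ; _×_)
open import Data.Sum using (_⊎_)
open import Data.List.Membership.Propositional using (_∈_)

open import Data.Product using (∃; _,_; proj₁; proj₂)
open import Data.Sum using (inj₁; inj₂; map₂)
open import Data.List using (List; []; _∷_; map)
open import Data.List.Relation.Unary.All as All using (_∷_)
open import Data.List.Relation.Unary.Any as Any using (Any; here)
open import Data.List.Relation.Unary.Any.Properties using (map⁺)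
open import Data.List.Membership.Propositional using (find; lose)
open import Data.Empty using (⊥-elim)
open import Relation.Nullary using (¬_; Dec; yes; no)
open import Relation.Nullary.Decidable using (_×-dec_)
open import Relation.Binary.PropositionalEquality using (_≡_; refl; sym; cong; cong₂; subst)
open import Relation.Binary.Construct.Closure.ReflexiveTransitive using (ε; _◅_)
open import Function.Bundles using (Equivalence)
import Function.Properties.Equivalence as ⇔
import Data.Integer as ℤ
import Data.Integer.Properties as ℤ

open Equivalence using (to; from)

≤ᴱ-refl : ∀ {a} → a ≤ᴱ a
≤ᴱ-refl { -∞}   = -∞≤
≤ᴱ-refl {fin _} = fin≤ ℤ.≤-refl
≤ᴱ-refl {+∞}    = ≤+∞

≤ᴱ-trans : ∀ {a b c} → a ≤ᴱ b → b ≤ᴱ c → a ≤ᴱ c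
≤ᴱ-trans -∞≤      _        = -∞≤
≤ᴱ-trans (fin≤ p) (fin≤ q) = fin≤ (ℤ.≤-trans p q)
≤ᴱ-trans (fin≤ _) ≤+∞      = ≤+∞
≤ᴱ-trans ≤+∞      ≤+∞      = ≤+∞

<ᴱ⇒≤ᴱ : ∀ {a b} → a <ᴱ b → a ≤ᴱ b
<ᴱ⇒≤ᴱ -∞<fin   = -∞≤
<ᴱ⇒≤ᴱ -∞<+∞    = -∞≤
<ᴱ⇒≤ᴱ (fin< p) = fin≤ (ℤ.<⇒≤ p)
<ᴱ⇒≤ᴱ fin<+∞   = ≤+∞

≮ᴱ⇒≥ᴱ : ∀ {a b} → ¬ (a <ᴱ b) → b ≤ᴱ a
≮ᴱ⇒≥ᴱ { -∞}   { -∞}   _   = -∞≤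
≮ᴱ⇒≥ᴱ { -∞}   {fin _} a≮b = ⊥-elim (a≮b -∞<fin)
≮ᴱ⇒≥ᴱ { -∞}   {+∞}    a≮b = ⊥-elim (a≮b -∞<+∞)
≮ᴱ⇒≥ᴱ {fin _} { -∞}   _   = -∞≤
≮ᴱ⇒≥ᴱ {fin _} {fin _} a≮b = fin≤ (ℤ.≮⇒≥ (λ p → a≮b (fin< p)))
≮ᴱ⇒≥ᴱ {fin _} {+∞}    a≮b = ⊥-elim (a≮b fin<+∞)
≮ᴱ⇒≥ᴱ {+∞}            _   = ≤+∞

module _ {V : Set} where

  _≗_ : Assignment V → Assignment V → Set
  α ≗ β = ∀ v → α v ≡ β v

  evalLin-cong : ∀ {α β} → α ≗ β → ∀ ts → evalLin α ts ≡ evalLin β ts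
  evalLin-cong α≗β []             = refl
  evalLin-cong α≗β ((c , v) ∷ ts) =
    cong₂ ℤ._+_ (cong (c ℤ.*_) (α≗β v)) (evalLin-cong α≗β ts)

  satCon-cong : ∀ {α β} → α ≗ β → ∀ c → satCon α c → satCon β c
  satCon-cong α≗β (lincon ts o r) = subst (λ l → holdsOp o l r) (evalLin-cong α≗β ts)

  satEq-cong : ∀ {α β} → α ≗ β → ∀ d → satEq α d → satEq β d
  satEq-cong α≗β (var≐ v c)    = subst (_≡ c) (α≗β v)
  satEq-cong α≗β (diff≐ v w c) = subst (_≡ c) (cong₂ ℤ._-_ (α≗β v) (α≗β w))

  satSub-cong : ∀ {α β} → α ≗ β → ∀ x → satSub α x → satSub β x
  satSub-cong α≗β x (sC , sD) =
    All.map (λ {c} → satCon-cong α≗β c) sC , All.map (λ {d} → satEq-cong α≗β d) sD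

  satSub-resp-≈S : ∀ α {x y : Subproblem V} → x ≈S y → satSub α x → satSub α y
  satSub-resp-≈S α (C≈ , D≈) (sC , sD) =
    All.tabulate (λ m → All.lookup sC (from (C≈ _) m)) ,
    All.tabulate (λ m → All.lookup sD (from (D≈ _) m))

  satCon? : ∀ α (c : LinCon V) → Dec (satCon α c)
  satCon? α (lincon ts `< r) = evalLin α ts ℤ.<? r
  satCon? α (lincon ts `≤ r) = evalLin α ts ℤ.≤? r
  satCon? α (lincon ts `= r) = evalLin α ts ℤ.≟ r
  satCon? α (lincon ts `> r) = r ℤ.<? evalLin α ts
  satCon? α (lincon ts `≥ r) = r ℤ.≤? evalLin α ts

  satEq? : ∀ α (d : SimpleEq V) → Dec (satEq α d)
  satEq? α (var≐ v c)    = α v ℤ.≟ c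
  satEq? α (diff≐ v w c) = (α v ℤ.- α w) ℤ.≟ c

  satSub? : ∀ α (x : Subproblem V) → Dec (satSub α x)
  satSub? α x = All.all? (satCon? α) (cons x) ×-dec All.all? (satEq? α) (eqs x)

  ≈S-refl : ∀ {x : Subproblem V} → x ≈S x
  ≈S-refl = (λ _ → ⇔.refl) , (λ _ → ⇔.refl)

  ∈⇒∈S : ∀ {x : Subproblem V} {P} → x ∈ P → x ∈S P
  ∈⇒∈S = Any.map (λ { refl → ≈S-refl })

  satisfied-∈S : ∀ α {P : List (Subproblem V)} → Any (satSub α) P →
                 ∃ λ y → y ∈S P × satSub α y
  satisfied-∈S α sP with find sP
  ... | y , y∈P , sy = y , ∈⇒∈S y∈P , sy

  satisfied-mono : ∀ α {P Q : List (Subproblem V)} → (∀ {y} → y ∈S P → y ∈S Q) →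
                   Any (satSub α) P → Any (satSub α) Q
  satisfied-mono α P⊆Q sP with satisfied-∈S α sP
  ... | y , y∈P , sy = Any.map (λ y≈z → satSub-resp-≈S α y≈z sy) (P⊆Q y∈P)

  -- y ≈S x need not be decidable; deciding whether α satisfies x suffices.
  satisfied-Replace : ∀ {L : Set} α {P x Q P'} → Replace P x Q P' →
                      Any (satSub α) P → (satSub α x → L ⊎ Any (satSub α) Q) →
                      L ⊎ Any (satSub α) P'
  satisfied-Replace α {x = x} (_ , P'≡) sP onX with satSub? α x
  ... | yes sx = map₂ (satisfied-mono α (λ q → from (P'≡ _) (inj₂ q))) (onX sx)
  ... | no ¬sx with satisfied-∈S α sP
  ...   | y , y∈P , sy = inj₂ (Any.map (λ y≈z → satSub-resp-≈S α y≈z sy) y∈P')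
    where y∈P' = from (P'≡ y) (inj₁ (y∈P , λ y≈x → ¬sx (satSub-resp-≈S α y≈x sy)))

module _ {V Atom : Set} (Sm : Semantics V Atom) (I : List (IAtom V Atom)) where

  ForcesI : Assignment V → Set
  ForcesI B = _⊨ZT_ Sm B (λ M → satI Sm M I)

  TModel⇒satSub : ∀ {B x} → TModel Sm B (satSubI Sm I x) → satSub B x
  TModel⇒satSub {x = x} ((M , M≗B) , B⊨) = satSub-cong M≗B x (proj₁ (B⊨ M M≗B))

  TModel⇒ForcesI : ∀ {B x} → TModel Sm B (satSubI Sm I x) → ForcesI B
  TModel⇒ForcesI (_ , B⊨) M M≗B = proj₂ (B⊨ M M≗B)

  satSub⇒TModel : ∀ {B x} → TConsistent Sm B → ForcesI B →
                  satSub B x → TModel Sm B (satSubI Sm I x)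
  satSub⇒TModel {x = x} tc B⊨I sx =
    tc , λ M M≗B → satSub-cong (λ v → sym (M≗B v)) x sx , B⊨I M M≗B

module Invariant {V Atom : Set} (Sm : Semantics V Atom) (inst : Instance V Atom)
                 (lb : Subproblem V → Ext) (lb-sound : LBSound (Instance.O inst) lb)
                 (B : Assignment V) (tc : TConsistent Sm B)
                 (B⊨I : ForcesI Sm (Instance.I inst) B) where
  open Semantics Sm
  open Instance inst
  open BC Sm inst lb

  BoundedOrAlive : State V → Set
  BoundedOrAlive S = (objS O (A S) ≤ᴱ fin (obj O B)) ⊎ Any (satSub B) (P S)

  objS-antitone : ∀ {S S'} → S ⟶ S' → objS O (A S') ≤ᴱ objS O (A S)
  objS-antitone (branch _ _ _ _ _)      = ≤ᴱ-refl
  objS-antitone (learn _ _ _ _)         = ≤ᴱ-refl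
  objS-antitone (forget _ _ _ _)        = ≤ᴱ-refl
  objS-antitone (propagate _ _ _ _)     = ≤ᴱ-refl
  objS-antitone (drop _ _ _)            = ≤ᴱ-refl
  objS-antitone (prune _ _ _ _)         = ≤ᴱ-refl
  objS-antitone (retire _ _ _ lt _ _)   = <ᴱ⇒≤ᴱ lt
  objS-antitone (unbounded _ _ _ _ _ _) = -∞≤
  objS-antitone (t-learn _ _ _ _)       = ≤ᴱ-refl

  objS-antitone* : ∀ {S S'} → S ⟶* S' → objS O (A S') ≤ᴱ objS O (A S)
  objS-antitone* ε        = ≤ᴱ-refl
  objS-antitone* (s ◅ ss) = ≤ᴱ-trans (objS-antitone* ss) (objS-antitone s)

  -- F is an arbitrary predicate, so the entailment is applied in a structure M realising B.
  t-learn-sound : ∀ {x : Subproblem V} c (F : Assignment V → Set) → x ⊨Z F →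
                  (∀ M → F (val M) → satI Sm M I → satCon (val M) c) →
                  satSub B x → satCon B c
  t-learn-sound {x} c F x⊨F F∧I⊨c sx =
    satCon-cong M≗B c (F∧I⊨c M (x⊨F (val M) (satSub-cong B≗M x sx)) (B⊨I M M≗B))
    where
      M = proj₁ tc
      M≗B = proj₂ tc
      B≗M : B ≗ val M
      B≗M v = sym (M≗B v)

  step-preserves : ∀ {S S'} → S ⟶ S' → Any (satSub B) (P S) → BoundedOrAlive S'
  step-preserves (branch Cs _ C⇔⋁Cs _ r) sP =
    satisfied-Replace B r sP λ (sC , sD) →
      inj₂ (map⁺ (Any.map (λ sCᵢ → sCᵢ , sD) (to (C⇔⋁Cs B sD) sC)))
  step-preserves (learn _ _ C⊨c r) sP =
    satisfied-Replace B r sP λ s → inj₂ (here (C⊨c B s ∷ proj₁ s , proj₂ s))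
  step-preserves (forget _ _ _ r) sP =
    satisfied-Replace B r sP λ { (_ ∷ sC , sD) → inj₂ (here (sC , sD)) }
  step-preserves (propagate _ _ C⊨d r) sP =
    satisfied-Replace B r sP λ s → inj₂ (here (proj₁ s , C⊨d B s ∷ proj₂ s))
  step-preserves (drop _ unsat r) sP =
    satisfied-Replace B r sP λ s → ⊥-elim (unsat (B , s))
  step-preserves (prune x _ A≤lb r) sP =
    satisfied-Replace B r sP λ s → inj₁ (≤ᴱ-trans A≤lb (≮ᴱ⇒≥ᴱ (lb-sound x B s)))
  step-preserves (retire x _ _ _ optimal r) sP =
    satisfied-Replace B r sP λ s → inj₁ (fin≤ (optimal B (satSub⇒TModel Sm I tc B⊨I s)))
  step-preserves (unbounded _ _ _ _ _ _) _ = inj₁ -∞≤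
  step-preserves (t-learn c _ (F , C⊨F , F∧I⊨c) r) sP =
    satisfied-Replace B r sP λ s → inj₂ (here (t-learn-sound c F C⊨F F∧I⊨c s ∷ proj₁ s , proj₂ s))

  steps-preserve : ∀ {S S'} → S ⟶* S' → Any (satSub B) (P S) → BoundedOrAlive S'
  steps-preserve ε        sP = inj₂ sP
  steps-preserve (s ◅ ss) sP with step-preserves s sP
  ... | inj₁ A≤B = inj₁ (≤ᴱ-trans (objS-antitone* ss) A≤B)
  ... | inj₂ sP' = steps-preserve ss sP'

lemma4 : {V Atom : Set} (Sm : Semantics V Atom) (inst : Instance V Atom)
         (lb : Subproblem V → Ext) → LBSound (Instance.O inst) lb →
         (S S' : State V) → BC._⟶*_ Sm inst lb S S' →
         (B : Assignment V) →
         (Σ (Subproblem V) λ x → x ∈ P S × TModel Sm B (satSubI Sm (Instance.I inst) x)) →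
         (objS (Instance.O inst) (A S') ≤ᴱ fin (obj (Instance.O inst) B))
         ⊎ (Σ (Subproblem V) λ x' → x' ∈ P S' × TModel Sm B (satSubI Sm (Instance.I inst) x'))
lemma4 {V} Sm inst lb lb-sound S S' S⟶*S' B (_ , x∈P , model) =
  map₂ satisfied⇒TModel (steps-preserve S⟶*S' (lose x∈P (TModel⇒satSub Sm I model)))
  where
    open Instance inst using (I)
    open Invariant Sm inst lb lb-sound B (proj₁ model) (TModel⇒ForcesI Sm I model)

    satisfied⇒TModel : Any (satSub B) (P S') →
                       Σ (Subproblem V) λ x' → x' ∈ P S' × TModel Sm B (satSubI Sm I x')
    satisfied⇒TModel sP' with find sP'
    ... | x' , x'∈P' , sx' =
      x' , x'∈P' , satSub⇒TModel Sm I (proj₁ model) (TModel⇒ForcesI Sm I model) sx'
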